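{- Let $1 \le j \le n-1$, let $k \ge 1$ be an integer, and let $(z,z') \in K_{j+1}^+ \cup K_{j+1}^-$ with $\|z\|_1 = k+1$, where, in case $j < s$, additionally $|z'| < p_{j+1,j+1}$. Then: (1) If there exists $(v,v') \in \mathcal{G}_{\le k}$ with $(v,v') \sqsubseteq_{j+1} (z,z')$, then $\mathrm{normalForm}((z,z'), \mathcal{G}_{\le k}) = 0$. (2) If there does not exist $(v,v') \in \mathcal{G}_{\le k}$ with $(v,v') \sqsubseteq_{j+1} (z,z')$, then $(z,z') \in \mathcal{G}_{k+1}$.
   Context: Let $1 \le s \le n$ and let $p_1,\dots,p_s \in \mathbb{Z}^n$ be such that $p_i$ has its first $i-1$ coordinates equal to $0$ and its $i$-th coordinate $p_{i,i} > 0$. Let $\Lambda \subseteq \mathbb{Z}^n$ be the lattice generated by $p_1,\dots,p_s$ over $\mathbb{Z}$. For $m \ge j$ let $\pi_j^m : \mathbb{R}^m \to \mathbb{R}^j$ be the projection onto the first $j$ coordinates. Let $K_j := \{\pi_j^n(v) : v \in \Lambda\}$, $K_j^+ := K_j \cap (\mathbb{R}_+^{j-1} \times \mathbb{R}_+)$, $K_j^- := K_j \cap (\mathbb{R}_+^{j-1} \times \mathbb{R}_-)$ (with $\mathbb{R}_+=[0,\infty)$, $\mathbb{R}_-=(-\infty,0]$), and let $H_j^+, H_j^-$ be the unique inclusion-minimal generating sets of the monoids $(K_j^+,+)$, $(K_j^-,+)$. Vectors of $\mathbb{Z}^{j+1}$ are written $(v,v')$ with $v \in \mathbb{Z}^j$,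 $v' \in \mathbb{Z}$, and $\|v\|_1 = \sum_{i=1}^j |v^{(i)}|$. For $i \ge 0$ let $\mathcal{G}_i := \{(v,v') \in H_{j+1}^+ \cup H_{j+1}^- : \|v\|_1 = i\}$ and $\mathcal{G}_{\le k} := \mathcal{G}_0 \cup \dots \cup \mathcal{G}_k$. For $u,v \in \mathbb{R}^{j+1}$ write $u \sqsubseteq_{j+1} v$ iff $u^{(i)} \le v^{(i)}$ for $i=1,\dots,j$, $|u^{(j+1)}| \le |v^{(j+1)}|$, and $u^{(j+1)} v^{(j+1)} \ge 0$. normalForm$(t,G)$ is the output of the following procedure: while there is some $g \in G$ with $g \sqsubseteq_{j+1} t$, pick such a $g$, set $\alpha := \min\{\lfloor t^{(i)}/g^{(i)} \rfloor : i = 1,\dots,j+1,\ g^{(i)} \ne 0\}$ and replace $t$ by $t - \alpha g$; when no such $g$ exists, return $t$. (The claim in (1) is that this procedure returns $0$.) -}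

module Defs where

open import Data.Nat as ℕ using (ℕ; zero; suc)
open import Data.Integer as ℤ using (ℤ; +_; -[1+_]; ∣_∣; 0ℤ; _/ℕ_)
open import Data.Fin using (Fin; zero; suc; inject≤; fromℕ<)
open import Data.Vec as Vec using (Vec; lookup; tabulate; replicate; zipWith; toList)
open import Data.List as List using (List; []; _∷_; _++_)
open import Data.List.Relation.Unary.All using (All)
open import Data.Maybe using (Maybe; just; nothing)
open import Data.Product using (_×_; _,_; proj₁; proj₂; ∃; ∃-syntax; Σ)
open import Data.Sum using (_⊎_)
open import Relation.Binary.PropositionalEquality using (_≡_)
open import Relation.Nullary using (¬_)
open import Relation.Binary.Construct.Closure.ReflexiveTransitive using (Star)
open import Level using (Level) renaming (suc to lsuc; zero to lzero)

-- Integer vectors; coordinates are 0-indexed (paper coordinate i = index i-1)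

ZVec : ℕ → Set
ZVec n = Vec ℤ n

_⊕_ : ∀ {n} → ZVec n → ZVec n → ZVec n
_⊕_ = zipWith ℤ._+_

_⊙_ : ∀ {n} → ℤ → ZVec n → ZVec n
c ⊙ v = Vec.map (c ℤ.*_) v

zeroV : ∀ {n} → ZVec n
zeroV = replicate _ 0ℤ

linComb : ∀ {s n} → (Fin s → ℤ) → (Fin s → ZVec n) → ZVec n
linComb {zero}  c p = zeroV
linComb {suc s} c p = (c zero ⊙ p zero) ⊕ linComb (λ i → c (suc i)) (λ i → p (suc i))

InΛ : ∀ {s n} → (Fin s → ZVec n) → ZVec n → Set
InΛ p w = ∃[ c ] w ≡ linComb c p

Triangular : ∀ {s n} → s ℕ.≤ n → (Fin s → ZVec n) → Set
Triangular {s} {n} s≤n p =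
  (i : Fin s) →
    ((k : Fin n) → Data.Fin.toℕ k ℕ.< Data.Fin.toℕ i → lookup (p i) k ≡ 0ℤ)
    × (0ℤ ℤ.< lookup (p i) (inject≤ i s≤n))

-- Vectors of ℤ^{j+1} written (v , v') with v ∈ ℤ^j, v' ∈ ℤ

V : ℕ → Set
V j = ZVec j × ℤ

_+V_ : ∀ {j} → V j → V j → V j
(v , v') +V (w , w') = (v ⊕ w , v' ℤ.+ w')

_-V_ : ∀ {j} → V j → V j → V j
(v , v') -V (w , w') = (zipWith ℤ._-_ v w , v' ℤ.- w')

_·V_ : ∀ {j} → ℤ → V j → V j
a ·V (v , v') = (a ⊙ v , a ℤ.* v')

0V : ∀ {j} → V j
0V = (zeroV , 0ℤ)

sumV : ∀ {j} → List (V j) → V j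
sumV []       = 0V
sumV (x ∷ xs) = x +V sumV xs

norm1 : ∀ {j} → ZVec j → ℕ
norm1 v = Vec.sum (Vec.map ∣_∣ v)

proj : ∀ {n j} → j ℕ.< n → ZVec n → V j
proj {n} {j} j<n w =
  (tabulate (λ i → lookup w (inject≤ i (Data.Nat.Properties.<⇒≤ j<n))) , lookup w (fromℕ< j<n))
  where import Data.Nat.Properties

K : ∀ {s n j} → (Fin s → ZVec n) → j ℕ.< n → V j → Set
K p j<n x = ∃[ w ] InΛ p w × proj j<n w ≡ x

NonnegV : ∀ {j} → ZVec j → Set
NonnegV v = ∀ i → 0ℤ ℤ.≤ lookup v i

Kplus : ∀ {s n j} → (Fin s → ZVec n) → j ℕ.< n → V j → Set
Kplus p j<n x = K p j<n x × NonnegV (proj₁ x) × 0ℤ ℤ.≤ proj₂ x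

Kminus : ∀ {s n j} → (Fin s → ZVec n) → j ℕ.< n → V j → Set
Kminus p j<n x = K p j<n x × NonnegV (proj₁ x) × proj₂ x ℤ.≤ 0ℤ

_⊆_ : ∀ {j} → (V j → Set) → (V j → Set) → Set
S ⊆ T = ∀ x → S x → T x

IsGenSet : ∀ {j} → (V j → Set) → (V j → Set) → Set
IsGenSet M S = (S ⊆ M) × (∀ x → M x → ∃[ l ] All S l × x ≡ sumV l)

IsMinGenSet : ∀ {j} → (V j → Set) → (V j → Set) → Set₁
IsMinGenSet M S = IsGenSet M S × (∀ S' → S' ⊆ S → IsGenSet M S' → S ⊆ S')

-- membership in the (unique) inclusion-minimal generating set of M:
-- h ∈ M and h lies in every inclusion-minimal generating set of M
InMinGen : ∀ {j} → (V j → Set) → V j → Set₁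
InMinGen M h = M h × (∀ S → IsMinGenSet M S → S h)

Hplus Hminus : ∀ {s n j} → (Fin s → ZVec n) → j ℕ.< n → V j → Set₁
Hplus  p j<n = InMinGen (Kplus p j<n)
Hminus p j<n = InMinGen (Kminus p j<n)

Gi : ∀ {s n j} → (Fin s → ZVec n) → j ℕ.< n → ℕ → V j → Set₁
Gi p j<n i x = (Hplus p j<n x ⊎ Hminus p j<n x) × Lift (lsuc lzero) (norm1 (proj₁ x) ≡ i)
  where open Level using (Lift)

Gle : ∀ {s n j} → (Fin s → ZVec n) → j ℕ.< n → ℕ → V j → Set₁
Gle p j<n k x = Σ ℕ (λ i → Lift (lsuc lzero) (i ℕ.≤ k) × Gi p j<n i x)
  where open Level using (Lift)

_⊑_ : ∀ {j} → V j → V j → Set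
(u , u') ⊑ (v , v') =
  (∀ i → lookup u i ℤ.≤ lookup v i) × (∣ u' ∣ ℕ.≤ ∣ v' ∣) × (0ℤ ℤ.≤ u' ℤ.* v')

floorDiv : ℤ → ℤ → Maybe ℤ
floorDiv a (+ zero)   = nothing
floorDiv a (+ suc m)  = just (a /ℕ suc m)
floorDiv a -[1+ m ]   = just ((ℤ.- a) /ℕ suc m)

minMaybe : Maybe ℤ → Maybe ℤ → Maybe ℤ
minMaybe nothing  y        = y
minMaybe (just x) nothing  = just x
minMaybe (just x) (just y) = just (x ℤ.⊓ y)

coords : ∀ {j} → V j → List ℤ
coords (v , v') = toList v ++ (v' ∷ [])

alpha : ∀ {j} → V j → V j → Maybe ℤ
alpha t g = List.foldr minMaybe nothing
              (List.zipWith floorDiv (coords t) (coords g))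

NFStep : ∀ {j} → (V j → Set₁) → V j → V j → Set₁
NFStep G t t' = Σ (V _) λ g → G g × Level.Lift (lsuc lzero) (g ⊑ t) ×
                  Σ ℤ (λ a → Level.Lift (lsuc lzero) (alpha t g ≡ just a × t' ≡ t -V (a ·V g)))

NFStop : ∀ {j} → (V j → Set₁) → V j → Set₁
NFStop G t = ¬ (Σ (V _) λ g → G g × Level.Lift (lsuc lzero) (g ⊑ t))

-- "normalForm(t, G) = 0": every run of the (nondeterministic) procedure
-- terminates (no infinite chain of steps from t), and every output is 0.
NormalFormIsZero : ∀ {j} → (V j → Set₁) → V j → Set₁
NormalFormIsZero G t =
  Acc (λ y x → NFStep G x y) t
  × (∀ r → Star (NFStep G) t r → NFStop G r → Level.Lift (lsuc lzero) (r ≡ 0V))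
  where open import Induction.WellFounded using (Acc)

-- A step of normalForm subtracts c·g with 1 ≤ c ≤ ⌊t⁽ⁱ⁾/g⁽ⁱ⁾⌋ for every coordinate where g⁽ⁱ⁾ ≠ 0, so
-- no coordinate changes sign and the ℓ¹-norm drops by c·‖g‖₁ > 0: every run terminates and stays in
-- K_{j+1} and in the orthant of (z,z'). A vertical lattice vector has last coordinate 0 or of absolute
-- value at least p_{j+1,j+1} > |z'|, so the first reducer of (z,z') has a nonzero first part and every
-- later remainder (r,r') has ‖r‖₁ ≤ k. If such a remainder is nonzero, some element of the minimal
-- generating set lies below it; that element has norm at most k, hence is in 𝒢_{≤k}, and the run goes
-- on. So runs can only stop at 0. For (2), write (z,z') as a sum of elements of a minimal generating
-- set: each summand lies below (z,z'), so if none is in 𝒢_{≤k} they all have norm at least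
-- k+1 = ‖z‖₁, and the only summand is (z,z') itself.
--
-- Minimal generating sets are unique because the order ≼ is antisymmetric on an orthant.

{-# OPTIONS --safe #-}
module Submission where

open import Data.Empty using (⊥-elim)
open import Data.Fin using (Fin; zero; suc; toℕ; fromℕ<; inject≤; punchIn)
import Data.Fin.Properties as FinP
open import Data.Integer as ℤ using (ℤ; +_; -[1+_]; +[1+_]; ∣_∣; 0ℤ; _◃_; +≤+)
import Data.Integer.Properties as ℤP
open import Data.Integer.Tactic.RingSolver using (solve-∀)
open import Data.List using (List; []; _∷_; _++_)
open import Data.List.Relation.Unary.All as All using (All; []; _∷_)
open import Data.List.Relation.Unary.All.Properties using (¬Any⇒All¬; ++⁺)
open import Data.List.Relation.Unary.Any as Any using ()
open import Data.Maybe using (just; nothing)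
open import Data.Maybe.Relation.Unary.All as Maybe using (just; nothing)
open import Data.Nat as ℕ using (ℕ; zero; suc; z≤n; s≤s)
import Data.Nat.DivMod as ℕD
open import Data.Nat.Induction using (<-wellFounded)
import Data.Nat.Properties as ℕP
open import Algebra.Properties.CommutativeSemigroup ℕP.+-commutativeSemigroup using (interchange)
open import Algebra.Properties.Semiring.Sum ℤP.+-*-semiring
  using (sum; sum-cong-≗; sum-remove; sum-replicate-zero; ∑-distrib-+; *-distribˡ-sum)
open import Data.Product using (_×_; _,_; proj₁; proj₂; Σ; ∃-syntax)
import Data.Product.Properties as ×P
open import Data.Sign as Sign using (Sign)
open import Data.Sum as Sum using (_⊎_; inj₁; inj₂; [_,_]′)
open import Data.Vec using ([]; _∷_; lookup; zipWith; tabulate)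
import Data.Vec.Properties as VP
open import Data.Vec.Relation.Binary.Pointwise.Extensional using (ext; Pointwise-≡⇒≡)
open import Function using (_∘_; id)
open import Induction.WellFounded using (Acc; module Subrelation)
open import Level using (Lift; lift)
import Level
open import Relation.Binary.Construct.Closure.ReflexiveTransitive using (Star; ε; _◅_)
import Relation.Binary.Construct.On as On
open import Relation.Binary.Definitions using (DecidableEquality; tri<; tri≈; tri>)
open import Relation.Binary.PropositionalEquality
open import Relation.Nullary using (¬_; Dec; yes; no)
open import Relation.Nullary.Decidable using (¬¬-excluded-middle)

open import Defs

HasSign : Sign → ℤ → Set
HasSign Sign.+ x = 0ℤ ℤ.≤ x
HasSign Sign.- x = x ℤ.≤ 0ℤ

infix 4 _⊑ℤ_
record _⊑ℤ_ (y x : ℤ) : Set where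
  constructor mk⊑ℤ
  field
    ∣∣-≤ : ∣ y ∣ ℕ.≤ ∣ x ∣
    sign-compatible : 0ℤ ℤ.≤ y ℤ.* x

+-sub-scaled : ∀ {m n} c → c ℕ.* n ℕ.≤ m → + m ℤ.- + c ℤ.* + n ≡ + (m ℕ.∸ c ℕ.* n)
+-sub-scaled {m} {n} c cn≤m = begin
  + m ℤ.- + c ℤ.* + n    ≡⟨ cong (λ u → + m ℤ.- u) (ℤP.pos-* c n) ⟨
  + m ℤ.- + (c ℕ.* n)    ≡⟨ ℤP.m-n≡m⊖n m (c ℕ.* n) ⟩
  m ℤ.⊖ (c ℕ.* n)        ≡⟨ ℤP.⊖-≥ cn≤m ⟩
  + (m ℕ.∸ c ℕ.* n)      ∎
  where open ≡-Reasoning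

sub-scaled : ∀ {x y} c → y ⊑ℤ x → c ℕ.* ∣ y ∣ ℕ.≤ ∣ x ∣ →
             x ℤ.- + c ℤ.* y ≡ ℤ.sign x ◃ (∣ x ∣ ℕ.∸ c ℕ.* ∣ y ∣)
sub-scaled {x} {+ zero} c _ _ = begin
  x ℤ.- + c ℤ.* 0ℤ                     ≡⟨ cong (λ u → x ℤ.- u) (ℤP.*-zeroʳ (+ c)) ⟩
  x ℤ.+ 0ℤ                             ≡⟨ ℤP.+-identityʳ x ⟩
  x                                    ≡⟨ ℤP.◃-inverse x ⟨
  ℤ.sign x ◃ ∣ x ∣                     ≡⟨ cong (λ u → ℤ.sign x ◃ (∣ x ∣ ℕ.∸ u)) (ℕP.*-zeroʳ c) ⟨
  ℤ.sign x ◃ (∣ x ∣ ℕ.∸ c ℕ.* 0)       ∎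
  where open ≡-Reasoning
sub-scaled {+ m} {+[1+ n ]} c _ cn≤m =
  trans (+-sub-scaled c cn≤m) (sym (ℤP.+◃n≡+n _))
sub-scaled { -[1+ m ]} { -[1+ n ]} c _ cn≤m = begin
  -[1+ m ] ℤ.- + c ℤ.* -[1+ n ]                  ≡⟨ negate -[1+ m ] -[1+ n ] (+ c) ⟩
  ℤ.- (+ suc m ℤ.- + c ℤ.* + suc n)              ≡⟨ cong ℤ.-_ (+-sub-scaled c cn≤m) ⟩
  ℤ.- + (suc m ℕ.∸ c ℕ.* suc n)                  ≡⟨ ℤP.-◃n≡-n _ ⟨
  Sign.- ◃ (suc m ℕ.∸ c ℕ.* suc n)               ∎
  where
  open ≡-Reasoning
  negate : ∀ x y a → x ℤ.- a ℤ.* y ≡ ℤ.- ((ℤ.- x) ℤ.- a ℤ.* (ℤ.- y))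
  negate = solve-∀
sub-scaled { -[1+ _ ]} {+[1+ _ ]} _ (mk⊑ℤ _ ()) _
sub-scaled {+ zero} { -[1+ _ ]} _ (mk⊑ℤ () _) _
sub-scaled {+[1+ _ ]} { -[1+ _ ]} _ (mk⊑ℤ _ ()) _

∣sub-scaled∣ : ∀ {x y} c → y ⊑ℤ x → c ℕ.* ∣ y ∣ ℕ.≤ ∣ x ∣ →
               ∣ x ℤ.- + c ℤ.* y ∣ ℕ.+ c ℕ.* ∣ y ∣ ≡ ∣ x ∣
∣sub-scaled∣ {x} {y} c y⊑x cy≤x = begin
  ∣ x ℤ.- + c ℤ.* y ∣ ℕ.+ c ℕ.* ∣ y ∣            ≡⟨ cong (λ u → ∣ u ∣ ℕ.+ c ℕ.* ∣ y ∣) (sub-scaled c y⊑x cy≤x) ⟩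
  ∣ ℤ.sign x ◃ (∣ x ∣ ℕ.∸ c ℕ.* ∣ y ∣) ∣ ℕ.+ c ℕ.* ∣ y ∣  ≡⟨ cong (ℕ._+ c ℕ.* ∣ y ∣) (ℤP.abs-◃ _ _) ⟩
  (∣ x ∣ ℕ.∸ c ℕ.* ∣ y ∣) ℕ.+ c ℕ.* ∣ y ∣         ≡⟨ ℕP.m∸n+n≡m cy≤x ⟩
  ∣ x ∣                                          ∎
  where open ≡-Reasoning

HasSign-sign◃ : ∀ σ {x} m → HasSign σ x → m ℕ.≤ ∣ x ∣ → HasSign σ (ℤ.sign x ◃ m)
HasSign-sign◃ Sign.+ {+ _} m _ _ = subst (0ℤ ℤ.≤_) (sym (ℤP.+◃n≡+n m)) (+≤+ z≤n)
HasSign-sign◃ Sign.- {+ zero} zero _ _ = +≤+ z≤n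
HasSign-sign◃ Sign.- {+[1+ _ ]} _ (+≤+ ()) _
HasSign-sign◃ Sign.- { -[1+ _ ]} m _ _ = subst (ℤ._≤ 0ℤ) (sym (ℤP.-◃n≡-n m)) ℤP.neg-≤-pos

HasSign-sub-scaled : ∀ σ {x y} c → y ⊑ℤ x → c ℕ.* ∣ y ∣ ℕ.≤ ∣ x ∣ →
                     HasSign σ x → HasSign σ (x ℤ.- + c ℤ.* y)
HasSign-sub-scaled σ {x} {y} c y⊑x cy≤x x∈σ =
  subst (HasSign σ) (sym (sub-scaled c y⊑x cy≤x)) (HasSign-sign◃ σ _ x∈σ (ℕP.m∸n≤m ∣ x ∣ (c ℕ.* ∣ y ∣)))

floorDiv-bound : ∀ {x y} c → y ⊑ℤ x → Maybe.All (+ c ℤ.≤_) (floorDiv x y) → c ℕ.* ∣ y ∣ ℕ.≤ ∣ x ∣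
floorDiv-bound {x} {+ zero} c _ _ = subst (ℕ._≤ ∣ x ∣) (sym (ℕP.*-zeroʳ c)) z≤n
floorDiv-bound {+ m} {+[1+ n ]} c _ (just (+≤+ c≤q)) =
  ℕP.≤-trans (ℕP.*-monoˡ-≤ (suc n) c≤q) (ℕD.m/n*n≤m m (suc n))
floorDiv-bound { -[1+ m ]} { -[1+ n ]} c _ (just (+≤+ c≤q)) =
  ℕP.≤-trans (ℕP.*-monoˡ-≤ (suc n) c≤q) (ℕD.m/n*n≤m (suc m) (suc n))
floorDiv-bound { -[1+ _ ]} {+[1+ _ ]} _ (mk⊑ℤ _ ()) _
floorDiv-bound {+ zero} { -[1+ _ ]} _ (mk⊑ℤ () _) _
floorDiv-bound {+[1+ _ ]} { -[1+ _ ]} _ (mk⊑ℤ _ ()) _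

floorDiv-just⇒divisor≢0 : ∀ {x y a} → floorDiv x y ≡ just a → 1 ℕ.≤ ∣ y ∣
floorDiv-just⇒divisor≢0 {y = +[1+ _ ]} _ = s≤s z≤n
floorDiv-just⇒divisor≢0 {y = -[1+ _ ]} _ = s≤s z≤n

floorDiv-just⇒1≤quotient : ∀ {x y a} → y ⊑ℤ x → floorDiv x y ≡ just a → + 1 ℤ.≤ a
floorDiv-just⇒1≤quotient {+ m} {+[1+ n ]} (mk⊑ℤ y≤x _) refl = +≤+ (ℕD.m≥n⇒m/n>0 y≤x)
floorDiv-just⇒1≤quotient { -[1+ m ]} { -[1+ n ]} (mk⊑ℤ y≤x _) refl = +≤+ (ℕD.m≥n⇒m/n>0 y≤x)
floorDiv-just⇒1≤quotient { -[1+ _ ]} {+[1+ _ ]} (mk⊑ℤ _ ()) _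
floorDiv-just⇒1≤quotient {+ zero} { -[1+ _ ]} (mk⊑ℤ () _) _
floorDiv-just⇒1≤quotient {+[1+ _ ]} { -[1+ _ ]} (mk⊑ℤ _ ()) _

∣∣-mono-≤-nonneg : ∀ {x y} → 0ℤ ℤ.≤ x → x ℤ.≤ y → ∣ x ∣ ℕ.≤ ∣ y ∣
∣∣-mono-≤-nonneg (+≤+ _) (+≤+ m≤n) = m≤n

i≤+∣j*i∣ : ∀ {i j} → j ≢ 0ℤ → 0ℤ ℤ.< i → i ℤ.≤ + ∣ j ℤ.* i ∣
i≤+∣j*i∣ {i} {j} j≢0 i>0 = begin
  i                    ≡⟨ ℤP.0≤i⇒+∣i∣≡i (ℤP.<⇒≤ i>0) ⟨
  + ∣ i ∣              ≤⟨ +≤+ (ℕP.m≤n*m ∣ i ∣ ∣ j ∣ {{ℕ.≢-nonZero (j≢0 ∘ ℤP.∣i∣≡0⇒i≡0)}}) ⟩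
  + (∣ j ∣ ℕ.* ∣ i ∣)  ≡⟨ cong +_ (ℤP.abs-* j i) ⟨
  + ∣ j ℤ.* i ∣        ∎
  where open ℤP.≤-Reasoning

HasSign-0 : ∀ σ → HasSign σ 0ℤ
HasSign-0 Sign.+ = +≤+ z≤n
HasSign-0 Sign.- = +≤+ z≤n

HasSign-+ : ∀ σ {x y} → HasSign σ x → HasSign σ y → HasSign σ (x ℤ.+ y)
HasSign-+ Sign.+ = ℤP.+-mono-≤
HasSign-+ Sign.- = ℤP.+-mono-≤

HasSign-* : ∀ σ {x y} → HasSign σ x → HasSign σ y → 0ℤ ℤ.≤ x ℤ.* y
HasSign-* Sign.+ {+ m} {+ n} _ _ = subst (0ℤ ℤ.≤_) (ℤP.pos-* m n) (+≤+ z≤n)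
HasSign-* Sign.- {+ zero} _ _ = +≤+ z≤n
HasSign-* Sign.- { -[1+ m ]} {+ zero} _ _ = subst (0ℤ ℤ.≤_) (sym (ℤP.*-zeroʳ -[1+ m ])) (+≤+ z≤n)
HasSign-* Sign.- { -[1+ _ ]} { -[1+ _ ]} _ _ = +≤+ z≤n
HasSign-* Sign.- {+[1+ _ ]} (+≤+ ()) _
HasSign-* Sign.- { -[1+ _ ]} {+[1+ _ ]} _ (+≤+ ())

∣+∣-HasSign : ∀ σ {x y} → HasSign σ x → HasSign σ y → ∣ x ℤ.+ y ∣ ≡ ∣ x ∣ ℕ.+ ∣ y ∣
∣+∣-HasSign Sign.+ (+≤+ _) (+≤+ _) = refl
∣+∣-HasSign Sign.- {+ zero} {y} _ _ = cong ∣_∣ (ℤP.+-identityˡ y)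
∣+∣-HasSign Sign.- { -[1+ m ]} {+ zero} _ _ = trans (cong ∣_∣ (ℤP.+-identityʳ -[1+ m ])) (sym (ℕP.+-identityʳ (suc m)))
∣+∣-HasSign Sign.- { -[1+ m ]} { -[1+ n ]} _ _ = cong suc (sym (ℕP.+-suc m n))
∣+∣-HasSign Sign.- {+[1+ _ ]} (+≤+ ()) _
∣+∣-HasSign Sign.- { -[1+ _ ]} {+[1+ _ ]} _ (+≤+ ())

∣∣-injective-HasSign : ∀ σ {x y} → HasSign σ x → HasSign σ y → ∣ x ∣ ≡ ∣ y ∣ → x ≡ y
∣∣-injective-HasSign Sign.+ (+≤+ _) (+≤+ _) refl = refl
∣∣-injective-HasSign Sign.- {+ zero} {+ zero} _ _ _ = refl
∣∣-injective-HasSign Sign.- { -[1+ _ ]} { -[1+ _ ]} _ _ refl = refl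
∣∣-injective-HasSign Sign.- {+[1+ _ ]} (+≤+ ()) _ _
∣∣-injective-HasSign Sign.- {_} {+[1+ _ ]} _ (+≤+ ()) _

-- The orthants of ℤʲ × ℤ

Orthant : ∀ {j} → Sign → V j → Set
Orthant σ x = NonnegV (proj₁ x) × HasSign σ (proj₂ x)

infix 4 _≼_
record _≼_ {j} (u v : V j) : Set where
  constructor mk≼
  field
    init-≤ : ∀ i → lookup (proj₁ u) i ℤ.≤ lookup (proj₁ v) i
    last-≤ : ∣ proj₂ u ∣ ℕ.≤ ∣ proj₂ v ∣

norm1V : ∀ {j} → V j → ℕ
norm1V x = norm1 (proj₁ x) ℕ.+ ∣ proj₂ x ∣

module _ {j : ℕ} where

  lookup-⊕ : (u v : ZVec j) (i : Fin j) → lookup (u ⊕ v) i ≡ lookup u i ℤ.+ lookup v i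
  lookup-⊕ u v i = VP.lookup-zipWith ℤ._+_ i u v

  lookup-sub-scaled : (u v : ZVec j) (a : ℤ) (i : Fin j) →
                      lookup (zipWith ℤ._-_ u (a ⊙ v)) i ≡ lookup u i ℤ.- a ℤ.* lookup v i
  lookup-sub-scaled u v a i =
    trans (VP.lookup-zipWith ℤ._-_ i u (a ⊙ v)) (cong (λ w → lookup u i ℤ.- w) (VP.lookup-map i (a ℤ.*_) v))

  +V-identityˡ : (x : V j) → 0V +V x ≡ x
  +V-identityˡ (v , v') = cong₂ _,_ (VP.zipWith-identityˡ ℤP.+-identityˡ v) (ℤP.+-identityˡ v')

  +V-identityʳ : (x : V j) → x +V 0V ≡ x
  +V-identityʳ (v , v') = cong₂ _,_ (VP.zipWith-identityʳ ℤP.+-identityʳ v) (ℤP.+-identityʳ v')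

  +V-assoc : (x y z : V j) → (x +V y) +V z ≡ x +V (y +V z)
  +V-assoc (x , x') (y , y') (z , z') = cong₂ _,_ (VP.zipWith-assoc ℤP.+-assoc x y z) (ℤP.+-assoc x' y' z')

  sumV-++ : (xs ys : List (V j)) → sumV (xs ++ ys) ≡ sumV xs +V sumV ys
  sumV-++ [] ys = sym (+V-identityˡ (sumV ys))
  sumV-++ (x ∷ xs) ys = trans (cong (x +V_) (sumV-++ xs ys)) (sym (+V-assoc x (sumV xs) (sumV ys)))

  module _ (σ : Sign) where

    orthant-0V : Orthant σ (0V {j})
    orthant-0V = (λ i → subst (0ℤ ℤ.≤_) (sym (VP.lookup-replicate i 0ℤ)) (+≤+ z≤n)) , HasSign-0 σ

    orthant-+V : ∀ {a b : V j} → Orthant σ a → Orthant σ b → Orthant σ (a +V b)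
    orthant-+V {a , _} {b , _} (a≥0 , a'∈σ) (b≥0 , b'∈σ) =
      (λ i → subst (0ℤ ℤ.≤_) (sym (lookup-⊕ a b i)) (ℤP.+-mono-≤ (a≥0 i) (b≥0 i))) , HasSign-+ σ a'∈σ b'∈σ

    orthant-sumV : ∀ {l : List (V j)} → All (Orthant σ) l → Orthant σ (sumV l)
    orthant-sumV [] = orthant-0V
    orthant-sumV {a ∷ l} (a∈σ ∷ l∈σ) = orthant-+V {a} {sumV l} a∈σ (orthant-sumV l∈σ)

    ≼-+ʳ : ∀ {a b : V j} → Orthant σ a → Orthant σ b → b ≼ a +V b
    ≼-+ʳ {a , a'} {b , b'} (a≥0 , a'∈σ) (_ , b'∈σ) =
      mk≼ (λ i → subst (lookup b i ℤ.≤_) (trans (ℤP.+-comm (lookup b i) (lookup a i)) (sym (lookup-⊕ a b i)))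
                       (ℤP.i≤i+j _ _ {{ℤ.nonNegative (a≥0 i)}}))
          (subst (∣ b' ∣ ℕ.≤_) (sym (∣+∣-HasSign σ a'∈σ b'∈σ)) (ℕP.m≤n+m ∣ b' ∣ ∣ a' ∣))

    ≼-+ˡ : ∀ {a b : V j} → Orthant σ a → Orthant σ b → a ≼ a +V b
    ≼-+ˡ {a , a'} {b , b'} (_ , a'∈σ) (b≥0 , b'∈σ) =
      mk≼ (λ i → subst (lookup a i ℤ.≤_) (sym (lookup-⊕ a b i)) (ℤP.i≤i+j _ _ {{ℤ.nonNegative (b≥0 i)}}))
          (subst (∣ a' ∣ ℕ.≤_) (sym (∣+∣-HasSign σ a'∈σ b'∈σ)) (ℕP.m≤m+n ∣ a' ∣ ∣ b' ∣))

  ≼-refl : ∀ {x : V j} → x ≼ x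
  ≼-refl = mk≼ (λ i → ℤP.≤-refl) ℕP.≤-refl

  ≼-trans : ∀ {x y z : V j} → x ≼ y → y ≼ z → x ≼ z
  ≼-trans (mk≼ x≤y x'≤y') (mk≼ y≤z y'≤z') = mk≼ (λ i → ℤP.≤-trans (x≤y i) (y≤z i)) (ℕP.≤-trans x'≤y' y'≤z')

  module _ {σ : Sign} where

    summands-≼-sumV : ∀ {l : List (V j)} → All (Orthant σ) l → All (_≼ sumV l) l
    summands-≼-sumV [] = []
    summands-≼-sumV {a ∷ l} (a∈σ ∷ l∈σ) =
      ≼-+ˡ σ {a} a∈σ Σl∈σ ∷ All.map (λ b≼Σl → ≼-trans b≼Σl (≼-+ʳ σ {a} a∈σ Σl∈σ)) (summands-≼-sumV l∈σ)
      where Σl∈σ = orthant-sumV σ l∈σ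

    ≼-antisym : ∀ {x y : V j} → Orthant σ x → Orthant σ y → x ≼ y → y ≼ x → x ≡ y
    ≼-antisym {x , x'} {y , y'} (_ , x'∈σ) (_ , y'∈σ) (mk≼ x≤y x'≤y') (mk≼ y≤x y'≤x') =
      cong₂ _,_ (Pointwise-≡⇒≡ (ext λ i → ℤP.≤-antisym (x≤y i) (y≤x i)))
                (∣∣-injective-HasSign σ x'∈σ y'∈σ (ℕP.≤-antisym x'≤y' y'≤x'))

    ≼⇒⊑ : ∀ {x y : V j} → Orthant σ x → Orthant σ y → x ≼ y → x ⊑ y
    ≼⇒⊑ (_ , x'∈σ) (_ , y'∈σ) (mk≼ x≤y x'≤y') = x≤y , x'≤y' , HasSign-* σ x'∈σ y'∈σ

norm1-zeroV : ∀ j → norm1 (zeroV {j}) ≡ 0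
norm1-zeroV zero = refl
norm1-zeroV (suc j) = norm1-zeroV j

norm1-⊕ : ∀ {j} (u v : ZVec j) → NonnegV u → NonnegV v → norm1 (u ⊕ v) ≡ norm1 u ℕ.+ norm1 v
norm1-⊕ [] [] _ _ = refl
norm1-⊕ (x ∷ u) (y ∷ v) u≥0 v≥0 = begin
  ∣ x ℤ.+ y ∣ ℕ.+ norm1 (u ⊕ v)                  ≡⟨ cong₂ ℕ._+_ (∣+∣-HasSign Sign.+ (u≥0 zero) (v≥0 zero))
                                                                (norm1-⊕ u v (u≥0 ∘ suc) (v≥0 ∘ suc)) ⟩
  (∣ x ∣ ℕ.+ ∣ y ∣) ℕ.+ (norm1 u ℕ.+ norm1 v)    ≡⟨ interchange ∣ x ∣ ∣ y ∣ (norm1 u) (norm1 v) ⟩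
  (∣ x ∣ ℕ.+ norm1 u) ℕ.+ (∣ y ∣ ℕ.+ norm1 v)    ∎
  where open ≡-Reasoning

norm1-mono : ∀ {j} (u v : ZVec j) → NonnegV u → (∀ i → lookup u i ℤ.≤ lookup v i) → norm1 u ℕ.≤ norm1 v
norm1-mono [] [] _ _ = z≤n
norm1-mono (x ∷ u) (y ∷ v) u≥0 u≤v =
  ℕP.+-mono-≤ (∣∣-mono-≤-nonneg (u≥0 zero) (u≤v zero)) (norm1-mono u v (u≥0 ∘ suc) (u≤v ∘ suc))

∣lookup∣≤norm1 : ∀ {j} (v : ZVec j) i → ∣ lookup v i ∣ ℕ.≤ norm1 v
∣lookup∣≤norm1 (x ∷ v) zero = ℕP.m≤m+n ∣ x ∣ (norm1 v)
∣lookup∣≤norm1 (x ∷ v) (suc i) = ℕP.≤-trans (∣lookup∣≤norm1 v i) (ℕP.m≤n+m (norm1 v) ∣ x ∣)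

norm1-sub-scaled : ∀ {j} c (v w : ZVec j) →
                   (∀ i → ∣ lookup v i ℤ.- + c ℤ.* lookup w i ∣ ℕ.+ c ℕ.* ∣ lookup w i ∣ ≡ ∣ lookup v i ∣) →
                   norm1 (zipWith ℤ._-_ v ((+ c) ⊙ w)) ℕ.+ c ℕ.* norm1 w ≡ norm1 v
norm1-sub-scaled c [] [] _ = ℕP.*-zeroʳ c
norm1-sub-scaled c (x ∷ v) (y ∷ w) split = begin
  (∣ x ℤ.- + c ℤ.* y ∣ ℕ.+ norm1 v') ℕ.+ c ℕ.* (∣ y ∣ ℕ.+ norm1 w)
    ≡⟨ cong ((∣ x ℤ.- + c ℤ.* y ∣ ℕ.+ norm1 v') ℕ.+_) (ℕP.*-distribˡ-+ c ∣ y ∣ (norm1 w)) ⟩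
  (∣ x ℤ.- + c ℤ.* y ∣ ℕ.+ norm1 v') ℕ.+ (c ℕ.* ∣ y ∣ ℕ.+ c ℕ.* norm1 w)
    ≡⟨ interchange ∣ x ℤ.- + c ℤ.* y ∣ (norm1 v') (c ℕ.* ∣ y ∣) (c ℕ.* norm1 w) ⟩
  (∣ x ℤ.- + c ℤ.* y ∣ ℕ.+ c ℕ.* ∣ y ∣) ℕ.+ (norm1 v' ℕ.+ c ℕ.* norm1 w)
    ≡⟨ cong₂ ℕ._+_ (split zero) (norm1-sub-scaled c v w (split ∘ suc)) ⟩
  ∣ x ∣ ℕ.+ norm1 v ∎
  where
  open ≡-Reasoning
  v' : ZVec _
  v' = zipWith ℤ._-_ v ((+ c) ⊙ w)

norm1≡0⇒≡0 : ∀ {j} (v : ZVec j) → norm1 v ≡ 0 → ∀ i → lookup v i ≡ 0ℤ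
norm1≡0⇒≡0 v ‖v‖≡0 i = ℤP.∣i∣≡0⇒i≡0 (ℕP.n≤0⇒n≡0 (subst (∣ lookup v i ∣ ℕ.≤_) ‖v‖≡0 (∣lookup∣≤norm1 v i)))

sole-summand : ∀ {j} σ k {l : List (V j)} → All (Orthant σ) l → All (λ f → k ℕ.< norm1 (proj₁ f)) l →
               norm1 (proj₁ (sumV l)) ≡ suc k → ∃[ f ] l ≡ f ∷ []
sole-summand {j} σ k {[]} _ _ ‖Σl‖≡1+k = ⊥-elim (ℕP.1+n≢0 (trans (sym ‖Σl‖≡1+k) (norm1-zeroV j)))
sole-summand σ k {f ∷ []} _ _ _ = f , refl
sole-summand σ k {f ∷ g ∷ l} (f∈σ ∷ g∈σ ∷ l∈σ) (k<‖f‖ ∷ k<‖g‖ ∷ _) ‖Σl‖≡1+k =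
  ⊥-elim (ℕP.<-irrefl refl (begin-strict
    suc k                                      <⟨ ℕP.m<m+n (suc k) (s≤s z≤n) ⟩
    suc k ℕ.+ suc k                            ≤⟨ ℕP.+-mono-≤ k<‖f‖ (ℕP.≤-trans k<‖g‖ (ℕP.m≤m+n _ _)) ⟩
    norm1 f₁ ℕ.+ (norm1 g₁ ℕ.+ norm1 Σl₁)       ≡⟨ cong (norm1 f₁ ℕ.+_) (norm1-⊕ g₁ Σl₁ (proj₁ g∈σ) (proj₁ Σl∈σ)) ⟨
    norm1 f₁ ℕ.+ norm1 (g₁ ⊕ Σl₁)              ≡⟨ norm1-⊕ f₁ (g₁ ⊕ Σl₁) (proj₁ f∈σ) (proj₁ (orthant-+V σ {g} g∈σ Σl∈σ)) ⟨
    norm1 (f₁ ⊕ (g₁ ⊕ Σl₁))                    ≡⟨ ‖Σl‖≡1+k ⟩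
    suc k                                      ∎))
  where
  open ℕP.≤-Reasoning
  f₁ = proj₁ f
  g₁ = proj₁ g
  Σl₁ = proj₁ (sumV l)
  Σl∈σ = orthant-sumV σ l∈σ

-- Minimal generating sets of a monoid inside an orthant

_≟V_ : ∀ {j} → DecidableEquality (V j)
_≟V_ = ×P.≡-dec (VP.≡-dec ℤP._≟_) ℤP._≟_

Generated : ∀ {j} → (V j → Set) → V j → Set
Generated S x = ∃[ l ] All S l × x ≡ sumV l

module _ {j} {S : V j → Set} where

  Generated-single : ∀ {x} → S x → Generated S x
  Generated-single {x} x∈S = x ∷ [] , x∈S ∷ [] , sym (+V-identityʳ x)

  Generated-+V : ∀ {a b} → Generated S a → Generated S b → Generated S (a +V b)
  Generated-+V (la , la⊆S , refl) (lb , lb⊆S , refl) = la ++ lb , ++⁺ la⊆S lb⊆S , sym (sumV-++ la lb)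

  Generated-sumV : ∀ {l} → All (Generated S) l → Generated S (sumV l)
  Generated-sumV [] = [] , [] , refl
  Generated-sumV (a-gen ∷ l-gen) = Generated-+V a-gen (Generated-sumV l-gen)

  Generated-trans : ∀ {T : V j → Set} {x} → (∀ {y} → T y → Generated S y) → Generated T x → Generated S x
  Generated-trans T⊆S (l , l⊆T , refl) = Generated-sumV (All.map T⊆S l⊆T)

module MinimalGeneratingSets {j} {σ : Sign} {M : V j → Set} (M⊆orthant : M ⊆ Orthant σ) where

  generators-≼ : ∀ {l} → All M l → All (_≼ sumV l) l
  generators-≼ l⊆M = summands-≼-sumV (All.map (M⊆orthant _) l⊆M)

  generated-avoiding : ∀ {S e f} → IsGenSet M S → M e → M f → f ≼ e → f ≢ e →
                       Generated (λ x → S x × x ≢ e) f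
  generated-avoiding {S} {e} {f} (S⊆M , generates) e∈M f∈M f≼e f≢e with generates f f∈M
  ... | l , l⊆S , refl = l , All.zipWith avoid (l⊆S , generators-≼ (All.map (S⊆M _) l⊆S)) , refl
    where
    avoid : ∀ {g} → S g × g ≼ f → S g × g ≢ e
    avoid (g∈S , g≼f) = g∈S , λ g≡e →
      f≢e (≼-antisym (M⊆orthant _ f∈M) (M⊆orthant _ e∈M) f≼e (subst (_≼ f) g≡e g≼f))

  -- If e is not among its own S'-summands, they all lie strictly below e, so S ∖ {e} still
  -- generates M, against the minimality of S.
  minGenSet-⊆ : ∀ {S S'} → IsMinGenSet M S → IsMinGenSet M S' → S ⊆ S'
  minGenSet-⊆ {S} {S'} (S-gen@(S⊆M , S-generates) , S-minimal) ((S'⊆M , S'-generates) , _) e e∈S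
    with S'-generates e (S⊆M e e∈S)
  ... | l , l⊆S' , e≡Σl with Any.any? (e ≟V_) l
  ...   | yes e∈l = All.lookup l⊆S' e∈l
  ...   | no e∉l = ⊥-elim (proj₂ (S-minimal S∖e (λ _ → proj₁) S∖e-gen e e∈S) refl)
    where
    S∖e : V j → Set
    S∖e x = S x × x ≢ e
    e-generated : Generated S∖e e
    e-generated = subst (Generated S∖e) (sym e≡Σl)
                    (Generated-sumV (All.zipWith summand-generated (l⊆S' , All.zip (l≼e , ¬Any⇒All¬ l e∉l))))
      where
      l≼e : All (_≼ e) l
      l≼e = All.map (subst (_ ≼_) (sym e≡Σl)) (generators-≼ (All.map (S'⊆M _) l⊆S'))
      summand-generated : ∀ {f} → S' f × f ≼ e × e ≢ f → Generated S∖e f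
      summand-generated (f∈S' , f≼e , e≢f) =
        generated-avoiding S-gen (S⊆M e e∈S) (S'⊆M _ f∈S') f≼e (e≢f ∘ sym)
    S∖e-generated : ∀ {s} → S s → Generated S∖e s
    S∖e-generated {s} s∈S with s ≟V e
    ... | yes refl = e-generated
    ... | no s≢e = Generated-single (s∈S , s≢e)
    S∖e-gen : IsGenSet M S∖e
    S∖e-gen = (λ x → S⊆M x ∘ proj₁) , λ x x∈M → Generated-trans S∖e-generated (S-generates x x∈M)

  minGenSet⇒InMinGen : ∀ {S} → IsMinGenSet M S → ∀ g → S g → InMinGen M g
  minGenSet⇒InMinGen S-min@((S⊆M , _) , _) g g∈S = S⊆M g g∈S , λ S' S'-min → minGenSet-⊆ S-min S'-min g g∈S

  minGenSet-below : ∀ {S x} → IsMinGenSet M S → M x → x ≢ 0V → Σ (V j) λ g → InMinGen M g × g ⊑ x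
  minGenSet-below S-min@((S⊆M , S-generates) , _) x∈M x≢0 with S-generates _ x∈M
  ... | [] , _ , x≡0 = ⊥-elim (x≢0 x≡0)
  ... | g ∷ l , gl⊆S@(g∈S ∷ _) , x≡Σ =
    g , minGenSet⇒InMinGen S-min g g∈S ,
    ≼⇒⊑ (M⊆orthant _ (S⊆M g g∈S)) (M⊆orthant _ x∈M)
        (subst (g ≼_) (sym x≡Σ) (All.head (generators-≼ (All.map (S⊆M _) gl⊆S))))

  InMinGen-below : ∀ {x} → M x → x ≢ 0V → ¬ ¬ (Σ (V j) λ g → InMinGen M g × g ⊑ x)
  InMinGen-below {x} x∈M x≢0 ∄g = ¬¬-excluded-middle {A = Σ (V j → Set) (IsMinGenSet M)} λ
    { (yes (S , S-min)) → ∄g (minGenSet-below S-min x∈M x≢0)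
    -- Membership in every minimal generating set is vacuous when there is none.
    ; (no ∄S) → ∄g (x , (x∈M , λ S S-min → ⊥-elim (∄S (S , S-min))) , ≼⇒⊑ {x = x} x∈σ x∈σ ≼-refl)
    }
    where x∈σ = M⊆orthant x x∈M

  norm-minimal⇒InMinGen : ∀ {z} k → M z → norm1 (proj₁ z) ≡ suc k →
                          (∀ g → InMinGen M g → g ⊑ z → k ℕ.< norm1 (proj₁ g)) → InMinGen M z
  norm-minimal⇒InMinGen {z} k z∈M ‖z‖≡1+k larger = z∈M , z∈S
    where
    z∈S : ∀ S → IsMinGenSet M S → S z
    z∈S S S-min@((S⊆M , S-generates) , _) = sole-generator (S-generates z z∈M)
      where
      sole-generator : Generated S z → S z
      sole-generator (l , l⊆S , z≡Σl) = subst S (sym z≡f) (All.head (subst (All S) l≡[f] l⊆S))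
        where
        l∈σ : All (Orthant σ) l
        l∈σ = All.map (λ f∈S → M⊆orthant _ (S⊆M _ f∈S)) l⊆S
        large : ∀ {f} → S f × f ≼ z → k ℕ.< norm1 (proj₁ f)
        large {f} (f∈S , f≼z) =
          larger f (minGenSet⇒InMinGen S-min f f∈S) (≼⇒⊑ (M⊆orthant _ (S⊆M f f∈S)) (M⊆orthant z z∈M) f≼z)
        l-large : All (λ f → k ℕ.< norm1 (proj₁ f)) l
        l-large = All.zipWith large (l⊆S , All.map (subst (_ ≼_) (sym z≡Σl)) (generators-≼ (All.map (S⊆M _) l⊆S)))
        sole = sole-summand σ k l∈σ l-large (trans (cong (norm1 ∘ proj₁) (sym z≡Σl)) ‖z‖≡1+k)
        f = proj₁ sole
        l≡[f] = proj₂ sole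
        z≡f : z ≡ f
        z≡f = trans z≡Σl (trans (cong sumV l≡[f]) (+V-identityʳ f))

-- The lattice Λ and its projections

sum-zero : ∀ {s} {f : Fin s → ℤ} → (∀ l → f l ≡ 0ℤ) → sum f ≡ 0ℤ
sum-zero {s} f≡0 = trans (sum-cong-≗ f≡0) (sum-replicate-zero s)

sum-single : ∀ {s} (f : Fin s → ℤ) i → (∀ l → l ≢ i → f l ≡ 0ℤ) → sum f ≡ f i
sum-single {suc s} f i zero-elsewhere = begin
  sum f                                   ≡⟨ sum-remove {i = i} f ⟩
  f i ℤ.+ sum (λ l → f (punchIn i l))     ≡⟨ cong (ℤ._+_ (f i)) (sum-zero (λ l → zero-elsewhere _ (FinP.punchInᵢ≢i i l))) ⟩
  f i ℤ.+ 0ℤ                              ≡⟨ ℤP.+-identityʳ (f i) ⟩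
  f i                                     ∎
  where open ≡-Reasoning

sum-sub-scaled : ∀ {s} (f g : Fin s → ℤ) a → sum (λ i → f i ℤ.- a ℤ.* g i) ≡ sum f ℤ.- a ℤ.* sum g
sum-sub-scaled f g a = begin
  sum (λ i → f i ℤ.- a ℤ.* g i)          ≡⟨ sum-cong-≗ (λ i → cong (ℤ._+_ (f i)) (ℤP.neg-distribˡ-* a (g i))) ⟩
  sum (λ i → f i ℤ.+ (ℤ.- a) ℤ.* g i)    ≡⟨ ∑-distrib-+ f (λ i → (ℤ.- a) ℤ.* g i) ⟩
  sum f ℤ.+ sum (λ i → (ℤ.- a) ℤ.* g i)  ≡⟨ cong (ℤ._+_ (sum f)) (*-distribˡ-sum (ℤ.- a) g) ⟨
  sum f ℤ.+ (ℤ.- a) ℤ.* sum g            ≡⟨ cong (ℤ._+_ (sum f)) (ℤP.neg-distribˡ-* a (sum g)) ⟨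
  sum f ℤ.- a ℤ.* sum g                  ∎
  where open ≡-Reasoning

module _ {s n : ℕ} (p : Fin s → ZVec n) where

  lookup-linComb : ∀ c k → lookup (linComb c p) k ≡ sum (λ i → c i ℤ.* lookup (p i) k)
  lookup-linComb c k = go c p
    where
    go : ∀ {s} (c : Fin s → ℤ) (p : Fin s → ZVec n) → lookup (linComb c p) k ≡ sum (λ i → c i ℤ.* lookup (p i) k)
    go {zero} c p = VP.lookup-replicate k 0ℤ
    go {suc s} c p = trans (lookup-⊕ (c zero ⊙ p zero) (linComb (c ∘ suc) (p ∘ suc)) k)
      (cong₂ ℤ._+_ (VP.lookup-map k (c zero ℤ.*_) (p zero)) (go (c ∘ suc) (p ∘ suc)))

  linComb-sub-scaled : ∀ c d a →
    zipWith ℤ._-_ (linComb c p) (a ⊙ linComb d p) ≡ linComb (λ i → c i ℤ.- a ℤ.* d i) p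
  linComb-sub-scaled c d a = Pointwise-≡⇒≡ (ext λ k → begin
    lookup (zipWith ℤ._-_ (linComb c p) (a ⊙ linComb d p)) k
      ≡⟨ lookup-sub-scaled (linComb c p) (linComb d p) a k ⟩
    lookup (linComb c p) k ℤ.- a ℤ.* lookup (linComb d p) k
      ≡⟨ cong₂ (λ x y → x ℤ.- a ℤ.* y) (lookup-linComb c k) (lookup-linComb d k) ⟩
    sum (λ i → c i ℤ.* lookup (p i) k) ℤ.- a ℤ.* sum (λ i → d i ℤ.* lookup (p i) k)
      ≡⟨ sum-sub-scaled (λ i → c i ℤ.* lookup (p i) k) (λ i → d i ℤ.* lookup (p i) k) a ⟨
    sum (λ i → c i ℤ.* lookup (p i) k ℤ.- a ℤ.* (d i ℤ.* lookup (p i) k))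
      ≡⟨ sum-cong-≗ (λ i → distrib (c i) a (d i) (lookup (p i) k)) ⟨
    sum (λ i → (c i ℤ.- a ℤ.* d i) ℤ.* lookup (p i) k)
      ≡⟨ lookup-linComb (λ i → c i ℤ.- a ℤ.* d i) k ⟨
    lookup (linComb (λ i → c i ℤ.- a ℤ.* d i) p) k ∎)
    where
    open ≡-Reasoning
    distrib : ∀ x a y q → (x ℤ.- a ℤ.* y) ℤ.* q ≡ x ℤ.* q ℤ.- a ℤ.* (y ℤ.* q)
    distrib = solve-∀

  InΛ-sub-scaled : ∀ {u v} a → InΛ p u → InΛ p v → InΛ p (zipWith ℤ._-_ u (a ⊙ v))
  InΛ-sub-scaled a (c , refl) (d , refl) = (λ i → c i ℤ.- a ℤ.* d i) , linComb-sub-scaled c d a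

proj-sub-scaled : ∀ {n j} (j<n : j ℕ.< n) (u v : ZVec n) a →
                  proj j<n (zipWith ℤ._-_ u (a ⊙ v)) ≡ proj j<n u -V (a ·V proj j<n v)
proj-sub-scaled j<n u v a = cong₂ _,_ (Pointwise-≡⇒≡ (ext λ i → begin
    lookup (tabulate (lookup (zipWith ℤ._-_ u (a ⊙ v)) ∘ ι)) i
      ≡⟨ VP.lookup∘tabulate _ i ⟩
    lookup (zipWith ℤ._-_ u (a ⊙ v)) (ι i)
      ≡⟨ lookup-sub-scaled u v a (ι i) ⟩
    lookup u (ι i) ℤ.- a ℤ.* lookup v (ι i)
      ≡⟨ cong₂ (λ x y → x ℤ.- a ℤ.* y) (VP.lookup∘tabulate _ i) (VP.lookup∘tabulate _ i) ⟨
    lookup (tabulate (lookup u ∘ ι)) i ℤ.- a ℤ.* lookup (tabulate (lookup v ∘ ι)) i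
      ≡⟨ lookup-sub-scaled (tabulate (lookup u ∘ ι)) _ a i ⟨
    lookup (zipWith ℤ._-_ (tabulate (lookup u ∘ ι)) (a ⊙ tabulate (lookup v ∘ ι))) i ∎))
  (lookup-sub-scaled u v a (fromℕ< j<n))
  where
  open ≡-Reasoning
  ι : Fin _ → Fin _
  ι i = inject≤ i (ℕP.<⇒≤ j<n)

K-sub-scaled : ∀ {s n j} {p : Fin s → ZVec n} (j<n : j ℕ.< n) {t g : V j} a →
               K p j<n t → K p j<n g → K p j<n (t -V (a ·V g))
K-sub-scaled {p = p} j<n a (u , u∈Λ , refl) (v , v∈Λ , refl) =
  zipWith ℤ._-_ u (a ⊙ v) , InΛ-sub-scaled p a u∈Λ v∈Λ , proj-sub-scaled j<n u v a

module TriangularBasis {s n} (s≤n : s ℕ.≤ n) (p : Fin s → ZVec n) (triangular : Triangular s≤n p) where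

  diagonal : Fin s → Fin n
  diagonal i = inject≤ i s≤n

  lookup-linComb-diagonal : ∀ c i → (∀ l → toℕ l ℕ.< toℕ i → c l ≡ 0ℤ) →
                            lookup (linComb c p) (diagonal i) ≡ c i ℤ.* lookup (p i) (diagonal i)
  lookup-linComb-diagonal c i earlier-vanish =
    trans (lookup-linComb p c (diagonal i)) (sum-single _ i off-diagonal)
    where
    off-diagonal : ∀ l → l ≢ i → c l ℤ.* lookup (p l) (diagonal i) ≡ 0ℤ
    off-diagonal l l≢i with ℕP.<-cmp (toℕ l) (toℕ i)
    ... | tri< l<i _ _ = cong (ℤ._* lookup (p l) (diagonal i)) (earlier-vanish l l<i)
    ... | tri≈ _ l≡i _ = ⊥-elim (l≢i (FinP.toℕ-injective l≡i))
    ... | tri> _ _ i<l = trans (cong (c l ℤ.*_) (proj₁ (triangular l) (diagonal i) ι<l)) (ℤP.*-zeroʳ (c l))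
      where ι<l = subst (ℕ._< toℕ l) (sym (FinP.toℕ-inject≤ i s≤n)) i<l

  -- Once c_l = 0 for all l < i, coordinate i of the combination is c_i · p_{i,i} with p_{i,i} > 0.
  leading-coefficients-vanish : ∀ c m → (∀ i → toℕ i ℕ.< m → lookup (linComb c p) (diagonal i) ≡ 0ℤ) →
                                ∀ i → toℕ i ℕ.< m → c i ≡ 0ℤ
  leading-coefficients-vanish c (suc m) diagonal-vanishes i i<1+m =
    [ id , (λ p-ii≡0 → ⊥-elim (ℤP.<-irrefl (sym p-ii≡0) (proj₂ (triangular i)))) ]′
      (ℤP.i*j≡0⇒i≡0∨j≡0 (c i) (trans (sym (lookup-linComb-diagonal c i earlier-vanish)) (diagonal-vanishes i i<1+m)))
    where
    earlier-vanish : ∀ l → toℕ l ℕ.< toℕ i → c l ≡ 0ℤ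
    earlier-vanish l l<i = leading-coefficients-vanish c m (λ i' i'<m → diagonal-vanishes i' (ℕP.m<n⇒m<1+n i'<m))
                             l (ℕP.<-≤-trans l<i (ℕ.s≤s⁻¹ i<1+m))

  K-vertical : ∀ {j} (j<n : j ℕ.< n) {v v'} → K p j<n (v , v') → (∀ i → lookup v i ≡ 0ℤ) →
               v' ≡ 0ℤ ⊎ Σ (j ℕ.< s) λ j<s → lookup (p (fromℕ< j<s)) (fromℕ< j<n) ℤ.≤ + ∣ v' ∣
  K-vertical {j} j<n (_ , (c , refl) , refl) v≡0 = vertical (j ℕP.<? s)
    where
    w : ZVec n
    w = linComb c p
    ι : Fin j → Fin n
    ι i = inject≤ i (ℕP.<⇒≤ j<n)
    w-vanishes-below-j : ∀ k → toℕ k ℕ.< j → lookup w k ≡ 0ℤ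
    w-vanishes-below-j k k<j = begin
      lookup w k                                         ≡⟨ cong (lookup w) k≡ι[k] ⟩
      lookup w (ι (fromℕ< k<j))                          ≡⟨ VP.lookup∘tabulate (lookup w ∘ ι) (fromℕ< k<j) ⟨
      lookup (tabulate (lookup w ∘ ι)) (fromℕ< k<j)      ≡⟨ v≡0 (fromℕ< k<j) ⟩
      0ℤ                                                 ∎
      where
      open ≡-Reasoning
      k≡ι[k] : k ≡ ι (fromℕ< k<j)
      k≡ι[k] = FinP.toℕ-injective (sym (trans (FinP.toℕ-inject≤ _ _) (FinP.toℕ-fromℕ< k<j)))
    c-vanish : ∀ l → toℕ l ℕ.< j → c l ≡ 0ℤ
    c-vanish = leading-coefficients-vanish c j λ i i<j →
      w-vanishes-below-j (diagonal i) (subst (ℕ._< j) (sym (FinP.toℕ-inject≤ i s≤n)) i<j)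
    vertical : Dec (j ℕ.< s) →
               lookup w (fromℕ< j<n) ≡ 0ℤ ⊎
               Σ (j ℕ.< s) λ j<s → lookup (p (fromℕ< j<s)) (fromℕ< j<n) ℤ.≤ + ∣ lookup w (fromℕ< j<n) ∣
    vertical (no j≮s) = inj₁ (trans (lookup-linComb p c (fromℕ< j<n)) (sum-zero λ l →
      cong (ℤ._* lookup (p l) (fromℕ< j<n)) (c-vanish l (ℕP.<-≤-trans (FinP.toℕ<n l) (ℕP.≮⇒≥ j≮s)))))
    vertical (yes j<s) = by-coefficient (c i ℤP.≟ 0ℤ)
      where
      i = fromℕ< j<s
      diagonal-i : diagonal i ≡ fromℕ< j<n
      diagonal-i = FinP.toℕ-injective
        (trans (FinP.toℕ-inject≤ i s≤n) (trans (FinP.toℕ-fromℕ< j<s) (sym (FinP.toℕ-fromℕ< j<n))))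
      w-j : lookup w (fromℕ< j<n) ≡ c i ℤ.* lookup (p i) (fromℕ< j<n)
      w-j = subst (λ k → lookup w k ≡ c i ℤ.* lookup (p i) k) diagonal-i
              (lookup-linComb-diagonal c i λ l l<i → c-vanish l (subst (toℕ l ℕ.<_) (FinP.toℕ-fromℕ< j<s) l<i))
      p-jj>0 : 0ℤ ℤ.< lookup (p i) (fromℕ< j<n)
      p-jj>0 = subst (λ k → 0ℤ ℤ.< lookup (p i) k) diagonal-i (proj₂ (triangular i))
      by-coefficient : Dec (c i ≡ 0ℤ) → _
      by-coefficient (yes c-i≡0) = inj₁ (trans w-j (cong (ℤ._* lookup (p i) (fromℕ< j<n)) c-i≡0))
      by-coefficient (no c-i≢0) =
        inj₂ (j<s , subst (λ u → lookup (p i) (fromℕ< j<n) ℤ.≤ + ∣ u ∣) (sym w-j) (i≤+∣j*i∣ c-i≢0 p-jj>0))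

-- One step of normalForm

Coordinatewise : ∀ {j} → (ℤ → ℤ → Set) → V j → V j → Set
Coordinatewise R t g = (∀ i → R (lookup (proj₁ t) i) (lookup (proj₁ g) i)) × R (proj₂ t) (proj₂ g)

SomeCoordinate : ∀ {j} → (ℤ → ℤ → Set) → V j → V j → Set
SomeCoordinate {j} R t g = (Σ (Fin j) λ i → R (lookup (proj₁ t) i) (lookup (proj₁ g) i)) ⊎ R (proj₂ t) (proj₂ g)

minMaybe-just : ∀ {m m' a} → minMaybe m m' ≡ just a → m ≡ just a ⊎ m' ≡ just a
minMaybe-just {nothing} m'≡a = inj₂ m'≡a
minMaybe-just {just x} {nothing} m≡a = inj₁ m≡a
minMaybe-just {just x} {just y} refl = Sum.map (cong just ∘ sym) (cong just ∘ sym) (ℤP.⊓-sel x y)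

minMaybe-lower : ∀ {m m' a} → Maybe.All (a ℤ.≤_) (minMaybe m m') → Maybe.All (a ℤ.≤_) m × Maybe.All (a ℤ.≤_) m'
minMaybe-lower {nothing} a≤m' = nothing , a≤m'
minMaybe-lower {just x} {nothing} a≤m = a≤m , nothing
minMaybe-lower {just x} {just y} (just a≤x⊓y) = just (ℤP.i≤j⊓k⇒i≤j x y a≤x⊓y) , just (ℤP.i≤j⊓k⇒i≤k x y a≤x⊓y)

alpha-attained : ∀ {j} (t g : V j) {a} → alpha t g ≡ just a → SomeCoordinate (λ x y → floorDiv x y ≡ just a) t g
alpha-attained ([] , x') ([] , y') α≡a with minMaybe-just {floorDiv x' y'} α≡a
... | inj₁ last≡a = inj₂ last≡a
alpha-attained (x ∷ v , x') (y ∷ w , y') α≡a with minMaybe-just {floorDiv x y} α≡a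
... | inj₁ head≡a = inj₁ (zero , head≡a)
... | inj₂ rest≡a = Sum.map₁ (λ (i , e) → suc i , e) (alpha-attained (v , x') (w , y') rest≡a)

alpha-lower : ∀ {j} (t g : V j) {a} → Maybe.All (a ℤ.≤_) (alpha t g) →
              Coordinatewise (λ x y → Maybe.All (a ℤ.≤_) (floorDiv x y)) t g
alpha-lower ([] , x') ([] , y') a≤α = (λ ()) , proj₁ (minMaybe-lower a≤α)
alpha-lower (x ∷ v , x') (y ∷ w , y') a≤α = (λ { zero → head ; (suc i) → proj₁ rest i }) , proj₂ rest
  where
  head = proj₁ (minMaybe-lower {floorDiv x y} a≤α)
  rest = alpha-lower (v , x') (w , y') (proj₂ (minMaybe-lower {floorDiv x y} a≤α))

-- A step t ↦ t - c·g with 1 ≤ c ≤ ⌊t⁽ⁱ⁾/g⁽ⁱ⁾⌋ wherever g⁽ⁱ⁾ ≠ 0: no coordinate changes sign, and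
-- each |t⁽ⁱ⁾| drops by exactly c·|g⁽ⁱ⁾|.
record Reduction {j} (c : ℕ) (g t : V j) : Set where
  field
    1≤c : 1 ℕ.≤ c
    0<‖g‖ : 1 ℕ.≤ norm1V g
    bounded : Coordinatewise (λ x y → y ⊑ℤ x × c ℕ.* ∣ y ∣ ℕ.≤ ∣ x ∣) t g

  remainder : V j
  remainder = t -V ((+ c) ·V g)

  norm1-split : norm1 (proj₁ remainder) ℕ.+ c ℕ.* norm1 (proj₁ g) ≡ norm1 (proj₁ t)
  norm1-split = norm1-sub-scaled c (proj₁ t) (proj₁ g) λ i →
    let (y⊑x , cy≤x) = proj₁ bounded i in ∣sub-scaled∣ c y⊑x cy≤x

  last-split : ∣ proj₂ remainder ∣ ℕ.+ c ℕ.* ∣ proj₂ g ∣ ≡ ∣ proj₂ t ∣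
  last-split = let (y⊑x , cy≤x) = proj₂ bounded in ∣sub-scaled∣ c y⊑x cy≤x

  norm1-≤ : norm1 (proj₁ remainder) ℕ.≤ norm1 (proj₁ t)
  norm1-≤ = subst (norm1 (proj₁ remainder) ℕ.≤_) norm1-split (ℕP.m≤m+n _ _)

  norm1-< : 1 ℕ.≤ norm1 (proj₁ g) → norm1 (proj₁ remainder) ℕ.< norm1 (proj₁ t)
  norm1-< 1≤‖g‖ = subst (norm1 (proj₁ remainder) ℕ.<_) norm1-split (ℕP.m<m+n _ (ℕP.*-mono-≤ 1≤c 1≤‖g‖))

  norm1V-< : norm1V remainder ℕ.< norm1V t
  norm1V-< = begin-strict
    norm1V remainder                            <⟨ ℕP.m<m+n _ (ℕP.*-mono-≤ 1≤c 0<‖g‖) ⟩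
    norm1V remainder ℕ.+ c ℕ.* norm1V g         ≡⟨ cong (norm1V remainder ℕ.+_) (ℕP.*-distribˡ-+ c ‖g‖ ∣g'∣) ⟩
    (‖r‖ ℕ.+ ∣r'∣) ℕ.+ (c ℕ.* ‖g‖ ℕ.+ c ℕ.* ∣g'∣)  ≡⟨ interchange ‖r‖ ∣r'∣ (c ℕ.* ‖g‖) (c ℕ.* ∣g'∣) ⟩
    (‖r‖ ℕ.+ c ℕ.* ‖g‖) ℕ.+ (∣r'∣ ℕ.+ c ℕ.* ∣g'∣)  ≡⟨ cong₂ ℕ._+_ norm1-split last-split ⟩
    norm1V t                                    ∎
    where
    open ℕP.≤-Reasoning
    ‖r‖ = norm1 (proj₁ remainder)
    ∣r'∣ = ∣ proj₂ remainder ∣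
    ‖g‖ = norm1 (proj₁ g)
    ∣g'∣ = ∣ proj₂ g ∣

  orthant : ∀ {σ} → Orthant σ t → Orthant σ remainder
  orthant {σ} (t≥0 , t'∈σ) =
    (λ i → let (y⊑x , cy≤x) = proj₁ bounded i in
      subst (0ℤ ℤ.≤_) (sym (lookup-sub-scaled (proj₁ t) (proj₁ g) (+ c) i)) (HasSign-sub-scaled Sign.+ c y⊑x cy≤x (t≥0 i))) ,
    (let (y⊑x , cy≤x) = proj₂ bounded in HasSign-sub-scaled σ c y⊑x cy≤x t'∈σ)

⊑⇒compatible : ∀ {j} (t g : V j) → NonnegV (proj₁ g) → g ⊑ t → Coordinatewise (λ x y → y ⊑ℤ x) t g
⊑⇒compatible _ _ g≥0 (g≤t , g'⊑t') =
  (λ i → mk⊑ℤ (∣∣-mono-≤-nonneg (g≥0 i) (g≤t i)) (HasSign-* Sign.+ (g≥0 i) (ℤP.≤-trans (g≥0 i) (g≤t i)))) ,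
  mk⊑ℤ (proj₁ g'⊑t') (proj₂ g'⊑t')

alpha-positive : ∀ {j} (t g : V j) {a} → Coordinatewise (λ x y → y ⊑ℤ x) t g → alpha t g ≡ just a →
                 + 1 ℤ.≤ a × 1 ℕ.≤ norm1V g
alpha-positive t g compatible α≡a with alpha-attained t g α≡a
... | inj₁ (i , q≡a) = floorDiv-just⇒1≤quotient (proj₁ compatible i) q≡a ,
  ℕP.≤-trans (floorDiv-just⇒divisor≢0 q≡a) (ℕP.≤-trans (∣lookup∣≤norm1 (proj₁ g) i) (ℕP.m≤m+n _ _))
... | inj₂ q≡a = floorDiv-just⇒1≤quotient (proj₂ compatible) q≡a ,
  ℕP.≤-trans (floorDiv-just⇒divisor≢0 q≡a) (ℕP.m≤n+m _ _)

alpha-reduction : ∀ {j} {t g : V j} {a} → NonnegV (proj₁ g) → g ⊑ t → alpha t g ≡ just a →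
                  ∃[ c ] a ≡ + c × Reduction c g t
alpha-reduction {t = t} {g} g≥0 g⊑t α≡a with alpha-positive t g (⊑⇒compatible t g g≥0 g⊑t) α≡a
... | +≤+ 1≤c , 0<‖g‖ = _ , refl , record
  { 1≤c = 1≤c
  ; 0<‖g‖ = 0<‖g‖
  ; bounded = (λ i → proj₁ compatible i , floorDiv-bound _ (proj₁ compatible i) (proj₁ lower i)) ,
              (proj₂ compatible , floorDiv-bound _ (proj₂ compatible) (proj₂ lower))
  }
  where
  compatible = ⊑⇒compatible t g g≥0 g⊑t
  lower = alpha-lower t g (subst (Maybe.All (_ ℤ.≤_)) (sym α≡a) (just ℤP.≤-refl))

module NormalForm {j} {G : V j → Set₁} (G-nonneg : ∀ g → G g → NonnegV (proj₁ g)) where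

  NFStep-reduction : ∀ {t t'} → NFStep G t t' →
                     Σ (V j) λ g → Σ ℕ λ c → G g × g ⊑ t × Reduction c g t × t' ≡ t -V ((+ c) ·V g)
  NFStep-reduction {t} (g , g∈G , lift g⊑t , a , lift (α≡a , refl))
    with alpha-reduction {t = t} {g} (G-nonneg g g∈G) g⊑t α≡a
  ... | c , refl , reduction = g , c , g∈G , g⊑t , reduction , refl

  NFStep-decreasing : ∀ {t t'} → NFStep G t t' → norm1V t' ℕ.< norm1V t
  NFStep-decreasing step with NFStep-reduction step
  ... | _ , _ , _ , _ , reduction , refl = Reduction.norm1V-< reduction

  NFStep-terminates : ∀ t → Acc (λ y x → NFStep G x y) t
  NFStep-terminates = Subrelation.wellFounded NFStep-decreasing (On.wellFounded norm1V <-wellFounded)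

module Corollary {s n} (s≤n : s ℕ.≤ n) (p : Fin s → ZVec n) (triangular : Triangular s≤n p)
                 {j} (j<n : j ℕ.< n) (k : ℕ) where

  Kσ : Sign → V j → Set
  Kσ σ x = K p j<n x × Orthant σ x

  G : V j → Set₁
  G = Gle p j<n k

  G⇒K×nonneg : ∀ g → G g → K p j<n g × NonnegV (proj₁ g)
  G⇒K×nonneg _ (_ , _ , inj₁ ((g∈K , g≥0 , _) , _) , _) = g∈K , g≥0
  G⇒K×nonneg _ (_ , _ , inj₂ ((g∈K , g≥0 , _) , _) , _) = g∈K , g≥0

  -- Kσ Sign.+ and Kσ Sign.- unfold to Kplus p j<n and Kminus p j<n.
  InMinGen⇒H : ∀ σ {g} → InMinGen (Kσ σ) g → Hplus p j<n g ⊎ Hminus p j<n g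
  InMinGen⇒H Sign.+ = inj₁
  InMinGen⇒H Sign.- = inj₂

  InMinGen⇒G : ∀ σ {g} → InMinGen (Kσ σ) g → norm1 (proj₁ g) ℕ.≤ k → G g
  InMinGen⇒G σ {g} g∈H ‖g‖≤k = norm1 (proj₁ g) , lift ‖g‖≤k , InMinGen⇒H σ g∈H , lift refl

  open NormalForm {G = G} (λ g → proj₂ ∘ G⇒K×nonneg g)

  module _ (σ : Sign) {z : V j} (z∈Kσ : Kσ σ z) (‖z‖≡1+k : norm1 (proj₁ z) ≡ suc k)
           (z'-small : (j<s : j ℕ.< s) → + ∣ proj₂ z ∣ ℤ.< lookup (p (fromℕ< j<s)) (fromℕ< j<n)) where

    open MinimalGeneratingSets {M = Kσ σ} (λ _ → proj₂)

    Reducible : Set₁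
    Reducible = Σ (V j) λ g → G g × Lift (Level.suc Level.zero) (g ⊑ z)

    -- A reducer with vanishing first part would be a vertical lattice vector, whose last coordinate
    -- is 0 or at least p_{j+1,j+1} > |z'|.
    reducer-nonvertical : ∀ {g c} → G g → g ⊑ z → Reduction c g z → 1 ℕ.≤ norm1 (proj₁ g)
    reducer-nonvertical {g} g∈G (_ , ∣g'∣≤∣z'∣ , _) reduction with norm1 (proj₁ g) ℕP.≟ 0
    ... | no ‖g‖≢0 = ℕP.n≢0⇒n>0 ‖g‖≢0
    ... | yes ‖g‖≡0
      with TriangularBasis.K-vertical s≤n p triangular j<n (proj₁ (G⇒K×nonneg g g∈G)) (norm1≡0⇒≡0 (proj₁ g) ‖g‖≡0)
    ...   | inj₁ g'≡0 =
      ⊥-elim (ℕP.n≮0 (subst (1 ℕ.≤_) (cong₂ ℕ._+_ ‖g‖≡0 (cong ∣_∣ g'≡0)) (Reduction.0<‖g‖ reduction)))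
    ...   | inj₂ (j<s , p-jj≤∣g'∣) =
      ⊥-elim (ℤP.<-irrefl refl (ℤP.<-≤-trans (z'-small j<s) (ℤP.≤-trans p-jj≤∣g'∣ (+≤+ ∣g'∣≤∣z'∣))))

    Invariant : V j → Set
    Invariant r = Kσ σ r × (r ≡ z ⊎ norm1 (proj₁ r) ℕ.≤ k)

    reduction-shrinks : ∀ {t g c} → t ≡ z ⊎ norm1 (proj₁ t) ℕ.≤ k → G g → g ⊑ t → (r : Reduction c g t) →
                        norm1 (proj₁ (Reduction.remainder r)) ℕ.≤ k
    reduction-shrinks (inj₁ refl) g∈G g⊑z r =
      ℕP.≤-pred (subst (norm1 (proj₁ (Reduction.remainder r)) ℕ.<_) ‖z‖≡1+k
                       (Reduction.norm1-< r (reducer-nonvertical g∈G g⊑z r)))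
    reduction-shrinks (inj₂ ‖t‖≤k) _ _ r = ℕP.≤-trans (Reduction.norm1-≤ r) ‖t‖≤k

    invariant-step : ∀ {t t'} → Invariant t → NFStep G t t' → Invariant t'
    invariant-step ((t∈K , t∈σ) , t-small) step with NFStep-reduction step
    ... | g , c , g∈G , g⊑t , r , refl =
      (K-sub-scaled j<n (+ c) t∈K (proj₁ (G⇒K×nonneg g g∈G)) , Reduction.orthant r t∈σ) ,
      inj₂ (reduction-shrinks t-small g∈G g⊑t r)

    invariant-star : ∀ {t r} → Invariant t → Star (NFStep G) t r → Invariant r
    invariant-star inv ε = inv
    invariant-star inv (step ◅ steps) = invariant-star (invariant-step inv step) steps

    stuck⇒≡0V : Reducible → ∀ {r} → Invariant r → NFStop G r → Lift (Level.suc Level.zero) (r ≡ 0V)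
    stuck⇒≡0V z-reducible (_ , inj₁ refl) stop = ⊥-elim (stop z-reducible)
    stuck⇒≡0V _ {r} (r∈Kσ , inj₂ ‖r‖≤k) stop with r ≟V 0V
    ... | yes r≡0 = lift r≡0
    ... | no r≢0 = ⊥-elim (InMinGen-below r∈Kσ r≢0 λ (g , g∈H , g⊑r) →
      stop (g , InMinGen⇒G σ g∈H (ℕP.≤-trans (‖g‖≤‖r‖ g∈H g⊑r) ‖r‖≤k) , lift g⊑r))
      where
      ‖g‖≤‖r‖ : ∀ {g} → InMinGen (Kσ σ) g → g ⊑ r → norm1 (proj₁ g) ℕ.≤ norm1 (proj₁ r)
      ‖g‖≤‖r‖ {g} ((_ , g≥0 , _) , _) (g≤r , _) = norm1-mono (proj₁ g) (proj₁ r) g≥0 g≤r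

    reducible⇒normalForm≡0 : Reducible → NormalFormIsZero G z
    reducible⇒normalForm≡0 z-reducible =
      NFStep-terminates z , λ r steps → stuck⇒≡0V z-reducible (invariant-star (z∈Kσ , inj₁ refl) steps)

    irreducible⇒G[k+1] : ¬ Reducible → Gi p j<n (suc k) z
    irreducible⇒G[k+1] irreducible = InMinGen⇒H σ (norm-minimal⇒InMinGen k z∈Kσ ‖z‖≡1+k larger) , lift ‖z‖≡1+k
      where
      larger : ∀ g → InMinGen (Kσ σ) g → g ⊑ z → k ℕ.< norm1 (proj₁ g)
      larger g g∈H g⊑z = ℕP.≰⇒> λ ‖g‖≤k → irreducible (g , InMinGen⇒G σ g∈H ‖g‖≤k , lift g⊑z)

    both-parts : (Reducible → NormalFormIsZero G z) × (¬ Reducible → Gi p j<n (suc k) z)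
    both-parts = reducible⇒normalForm≡0 , irreducible⇒G[k+1]

corollary3p2 : (n s : ℕ) → 1 ℕ.≤ s → (s≤n : s ℕ.≤ n) →
    (p : Fin s → ZVec n) → Triangular s≤n p →
    (j : ℕ) → 1 ℕ.≤ j → (j<n : j ℕ.< n) →
    (k : ℕ) → 1 ℕ.≤ k →
    (z : ZVec j) (z' : ℤ) →
    (Kplus p j<n (z , z') ⊎ Kminus p j<n (z , z')) →
    norm1 z ≡ suc k →
    ((j<s : j ℕ.< s) → + ∣ z' ∣ ℤ.< lookup (p (fromℕ< j<s)) (fromℕ< j<n)) →
    ((Σ (V j) λ g → Gle p j<n k g × Lift (Level.suc Level.zero) (g ⊑ (z , z')))
       → NormalFormIsZero (Gle p j<n k) (z , z'))
    ×
    (¬ (Σ (V j) λ g → Gle p j<n k g × Lift (Level.suc Level.zero) (g ⊑ (z , z')))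
       → Gi p j<n (suc k) (z , z'))
corollary3p2 n s _ s≤n p triangular j _ j<n k _ z z' (inj₁ z∈K⁺) =
  Corollary.both-parts s≤n p triangular j<n k Sign.+ {z , z'} z∈K⁺
corollary3p2 n s _ s≤n p triangular j _ j<n k _ z z' (inj₂ z∈K⁻) =
  Corollary.both-parts s≤n p triangular j<n k Sign.- {z , z'} z∈K⁻
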